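{- Let $\mathfrak{M}=(T,<,I,V)$ and $\mathfrak{M}'=(T',<',I',V')$ be models, $(t,\pi)$ a couple of $\mathfrak{M}$ and $(t,\pi)'$ a couple of $\mathfrak{M}'$, and suppose there is a bisimulation between $(\mathfrak{M},(t,\pi))$ and $(\mathfrak{M}',(t,\pi)')$. Then for every formula $\varphi$ (built from propositional variables with $\neg,\wedge,G,H,L$), $\mathfrak{M},(t,\pi)\models\varphi$ iff $\mathfrak{M}',(t,\pi)'\models\varphi$.
   Context: A tree is a pair $(T,<)$ with $<$ irreflexive, transitive and downward linear (if $b<a$ and $c<a$ then $b=c$, $b<c$ or $c<b$). A history is a $\subseteq$-maximal $<$-linear subset of $T$; $H_t$ is the set of histories containing $t$. An indistinguishability function assigns to each $t$ an equivalence relation $I_t$ on $H_t$ such that $hI_tk$ and $s<t$ imply $hI_sk$. $\Pi_t$ is the set of $I_t$-classes, $[h]_{I_s}$ the $I_s$-class of $h$. A model is $(T,<,I,V)$ with $(T,<)$ a tree, $I$ an indistinguishability function and $V$ mapping each propositional variable to a set of couples, couples being the elements of $\bigcup_{t\in T}(\{t\}\times\Pi_t)$. Satisfaction at $(t,\pi)$: $p$ iff $(t,\pi)\in V(p)$; Boolean clauses as usual; $G\varphi$ iff for each $h\in\pi$ and $s\in h$ with $t<s$, $\varphi$ holds at $(s,[h]_{I_s})$; $H\varphi$ iff for each $h\in\pi$ and $s\in h$ with $s<t$, $\varphi$ holds at $(s,[h]_{I_s})$; $L\varphi$ iff for each $\rho\in\Pi_t$, $\varphi$ holds at $(t,\rho)$.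 On couples: $(t,\pi)\prec(s,\rho)$ iff $t<s$ and $\pi\supseteq\rho$; $\succ$ is the converse of $\prec$; $(t,\pi)\sim(s,\rho)$ iff $t=s$; primed versions in $\mathfrak{M}'$. A bisimulation between $(\mathfrak{M},(t,\pi))$ and $(\mathfrak{M}',(t,\pi)')$ is a relation $B$ between couples of $\mathfrak{M}$ and couples of $\mathfrak{M}'$ with $(t,\pi)B(t,\pi)'$ such that whenever $xBx'$: (PV) for every propositional variable $p$, $x\in V(p)$ iff $x'\in V'(p)$; and for each $R\in\{\prec,\succ,\sim\}$ with primed counterpart $R'$: (forth) for every couple $y$ of $\mathfrak{M}$ with $xRy$ there is a couple $y'$ of $\mathfrak{M}'$ with $x'R'y'$ and $yBy'$; (back) for every couple $y'$ of $\mathfrak{M}'$ with $x'R'y'$ there is a couple $y$ of $\mathfrak{M}$ with $xRy$ and $yBy'$. -}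

module Defs where

open import Data.Nat using (ℕ)
open import Data.Product using (Σ; _×_; _,_; ∃)
open import Data.Sum using (_⊎_)
open import Data.Empty using (⊥)
open import Relation.Nullary using (¬_)
open import Relation.Binary.PropositionalEquality using (_≡_)
open import Function.Bundles using (_⇔_; mk⇔)
open import Level using (Lift; suc; zero)

Sub : Set → Set₁
Sub T = T → Set

record Tree : Set₂ where
  field
    T     : Set
    _<_   : T → T → Set
    irrefl : ∀ x → ¬ (x < x)
    trans  : ∀ {x y z} → x < y → y < z → x < z
    downLinear : ∀ {a b c} → b < a → c < a → (b ≡ c) ⊎ (b < c) ⊎ (c < b)

  Linear : Sub T → Set
  Linear S = ∀ x y → S x → S y → (x ≡ y) ⊎ (x < y) ⊎ (y < x)

  History : Sub T → Set₁
  History h = Linear h × (∀ (S : Sub T) → Linear S → (∀ x → h x → S x) → ∀ x → S x → h x)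

  Hist : T → Sub T → Set₁
  Hist t h = History h × h t

  _≐_ : Sub T → Sub T → Set
  h ≐ k = ∀ x → (h x ⇔ k x)

record Indist (𝒯 : Tree) : Set₂ where
  open Tree 𝒯
  field
    I : T → Sub T → Sub T → Set
    dom   : ∀ {t h k} → I t h k → Hist t h × Hist t k
    refl  : ∀ {t h} → Hist t h → I t h h
    sym   : ∀ {t h k} → I t h k → I t k h
    trans : ∀ {t h k l} → I t h k → I t k l → I t h l
    mono  : ∀ {t s h k} → I t h k → s < t → I s h k
    -- histories are sets: I depends only on their extension
    ext   : ∀ {t h h' k k'} → h ≐ h' → k ≐ k' → I t h k → I t h' k'

module _ {𝒯 : Tree} (𝓘 : Indist 𝒯) where
  open Tree 𝒯
  open Indist 𝓘

  IsClass : T → (Sub T → Set) → Set₁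
  IsClass t π = Σ (Sub T) λ h → Hist t h × (∀ k → (π k ⇔ I t h k))

  record Couple : Set₂ where
    constructor couple
    field
      time    : T
      cls     : Sub T → Set
      isClass : IsClass time cls

  open Couple public

  classOf : (s : T) (h : Sub T) → Hist s h → Couple
  classOf s h hh = couple s (I s h) (h , hh , λ k → mk⇔ (λ x → x) (λ x → x))

  SameCouple : Couple → Couple → Set₁
  SameCouple x y = (time x ≡ time y) × (∀ k → (cls x k ⇔ cls y k))

  _≺_ : Couple → Couple → Set₁
  x ≺ y = (time x < time y) × (∀ k → cls y k → cls x k)

  _≻_ : Couple → Couple → Set₁
  x ≻ y = y ≺ x

  _∼_ : Couple → Couple → Set
  x ∼ y = time x ≡ time y

record Model : Set₃ where
  field
    tree  : Tree
    indist : Indist tree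
    V     : ℕ → Couple indist → Set
    -- V maps variables to *sets* of couples: it respects equality of couples
    V-ext : ∀ p x y → SameCouple indist x y → V p x → V p y

  open Tree tree public
  open Indist indist public

data Formula : Set where
  var : ℕ → Formula
  ¬'_ : Formula → Formula
  _∧'_ : Formula → Formula → Formula
  G H L : Formula → Formula

module _ (𝔐 : Model) where
  open Model 𝔐

  _⊨_ : Couple indist → Formula → Set₂
  x ⊨ var p = Lift (suc (suc zero)) (V p x)
  x ⊨ (¬' φ) = ¬ (x ⊨ φ)
  x ⊨ (φ ∧' ψ) = (x ⊨ φ) × (x ⊨ ψ)
  x ⊨ G φ = ∀ (h : Sub T) → cls x h → ∀ (s : T) → (hs : Hist s h) → time x < s
              → classOf indist s h hs ⊨ φ
  x ⊨ H φ = ∀ (h : Sub T) → cls x h → ∀ (s : T) → (hs : Hist s h) → s < time x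
              → classOf indist s h hs ⊨ φ
  x ⊨ L φ = ∀ (ρ : Sub T → Set) → (c : IsClass indist (time x) ρ)
              → couple (time x) ρ c ⊨ φ

record Bisimulation (𝔐 𝔐' : Model) (x₀ : Couple (Model.indist 𝔐)) (x₀' : Couple (Model.indist 𝔐')) : Set₃ where
  open Model 𝔐 using (indist; V)
  open Model 𝔐' using () renaming (indist to indist'; V to V')
  field
    B : Couple indist → Couple indist' → Set₁
    root : B x₀ x₀'
    PV : ∀ {x x'} → B x x' → ∀ p → (V p x ⇔ V' p x')
    ≺-forth : ∀ {x x'} → B x x' → ∀ y → _≺_ indist x y → Σ (Couple indist') λ y' → _≺_ indist' x' y' × B y y'
    ≺-back  : ∀ {x x'} → B x x' → ∀ y' → _≺_ indist' x' y' → Σ (Couple indist) λ y → _≺_ indist x y × B y y'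
    ≻-forth : ∀ {x x'} → B x x' → ∀ y → _≻_ indist x y → Σ (Couple indist') λ y' → _≻_ indist' x' y' × B y y'
    ≻-back  : ∀ {x x'} → B x x' → ∀ y' → _≻_ indist' x' y' → Σ (Couple indist) λ y → _≻_ indist x y × B y y'
    ∼-forth : ∀ {x x'} → B x x' → ∀ y → _∼_ indist x y → Σ (Couple indist') λ y' → _∼_ indist' x' y' × B y y'
    ∼-back  : ∀ {x x'} → B x x' → ∀ y' → _∼_ indist' x' y' → Σ (Couple indist) λ y → _∼_ indist x y × B y y'

-- Each modality is a box over one of the relations on couples: G over ≺, H over ≻
-- and L over ∼. For G and H this rests on a couple being the class of any of its
-- members, so that the couples (s , [h]_{I_s}) reached by G and H are exactly the
-- ≺- resp. ≻-successors up to equality of couples, which truth respects. A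
-- bisimulation has forth and back clauses for each relation, so truth transfers
-- along it by induction on the formula.
module Submission where

open import Defs
open import Data.Product using (Σ; _×_; _,_; proj₁; proj₂)
open import Data.Product.Function.NonDependent.Propositional using (_×-⇔_)
open import Function.Bundles using (_⇔_; mk⇔; Equivalence)
open import Function.Related.TypeIsomorphisms using (¬-cong-⇔)
open import Level using (lift; lower)
open import Relation.Binary.PropositionalEquality using (refl; sym)
import Function.Properties.Equivalence as ⇔

open Equivalence

□-cong-⇔ : ∀ {a a′ r r′ b p p′} {X : Set a} {X′ : Set a′}
  {B : X → X′ → Set b} {P : X → Set p} {P′ : X′ → Set p′} {x : X} {x′ : X′}
  (R : X → X → Set r) (R′ : X′ → X′ → Set r′) →
  (∀ y → R x y → Σ X′ λ y′ → R′ x′ y′ × B y y′) →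
  (∀ y′ → R′ x′ y′ → Σ X λ y → R x y × B y y′) →
  (∀ {y y′} → B y y′ → P y ⇔ P′ y′) →
  (∀ y → R x y → P y) ⇔ (∀ y′ → R′ x′ y′ → P′ y′)
□-cong-⇔ R R′ forth back P⇔P′ = mk⇔
  (λ □P y′ xR′y′ → let (y , xRy , yBy′) = back y′ xR′y′ in to (P⇔P′ yBy′) (□P y xRy))
  (λ □P′ y xRy → let (y′ , x′R′y′ , yBy′) = forth y xRy in from (P⇔P′ yBy′) (□P′ y′ x′R′y′))

module Semantics (𝔐 : Model) where
  open Model 𝔐 using (tree; indist; V-ext)
  open Tree tree using (Hist)
  module I = Indist indist

  Couple𝔐 : Set₂
  Couple𝔐 = Couple indist

  member-Hist : ∀ (y : Couple𝔐) {h} → cls y h → Hist (time y) h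
  member-Hist y {h} h∈y with isClass y
  ... | _ , _ , y≡[g] = proj₂ (I.dom (to (y≡[g] h) h∈y))

  classOf-member : ∀ (y : Couple𝔐) {h} (h∈y : cls y h) →
    SameCouple indist (classOf indist (time y) h (member-Hist y h∈y)) y
  classOf-member y {h} h∈y with isClass y
  ... | g , _ , y≡[g] = refl , λ k →
    mk⇔ (λ hIk → from (y≡[g] k) (I.trans gIh hIk))
        (λ k∈y → I.trans (I.sym gIh) (to (y≡[g] k) k∈y))
    where gIh = to (y≡[g] h) h∈y

  representative-∈ : ∀ (y : Couple𝔐) → cls y (proj₁ (isClass y))
  representative-∈ y with isClass y
  ... | g , g∈H , y≡[g] = from (y≡[g] g) (I.refl g∈H)

  SameCouple-sym : ∀ {x y : Couple𝔐} → SameCouple indist x y → SameCouple indist y x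
  SameCouple-sym (t≡s , π⇔ρ) = sym t≡s , λ k → ⇔.sym (π⇔ρ k)

  ⊨-resp-SameCouple : ∀ φ {x y : Couple𝔐} → SameCouple indist x y → _⊨_ 𝔐 x φ → _⊨_ 𝔐 y φ
  ⊨-resp-SameCouple (var p) x≈y x⊨p = lift (V-ext p _ _ x≈y (lower x⊨p))
  ⊨-resp-SameCouple (¬' φ) {x} {y} x≈y x⊭φ y⊨φ =
    x⊭φ (⊨-resp-SameCouple φ (SameCouple-sym {x} {y} x≈y) y⊨φ)
  ⊨-resp-SameCouple (φ ∧' ψ) x≈y (x⊨φ , x⊨ψ) =
    ⊨-resp-SameCouple φ x≈y x⊨φ , ⊨-resp-SameCouple ψ x≈y x⊨ψ
  ⊨-resp-SameCouple (G φ) (refl , π⇔ρ) x⊨Gφ h h∈y = x⊨Gφ h (from (π⇔ρ h) h∈y)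
  ⊨-resp-SameCouple (H φ) (refl , π⇔ρ) x⊨Hφ h h∈y = x⊨Hφ h (from (π⇔ρ h) h∈y)
  ⊨-resp-SameCouple (L φ) (refl , _) x⊨Lφ = x⊨Lφ

  ⊨-G⇔ : ∀ φ x → _⊨_ 𝔐 x (G φ) ⇔ (∀ y → _≺_ indist x y → _⊨_ 𝔐 y φ)
  ⊨-G⇔ φ x = mk⇔ ⇒ ⇐
    where
    ⇒ : _⊨_ 𝔐 x (G φ) → ∀ y → _≺_ indist x y → _⊨_ 𝔐 y φ
    ⇒ x⊨Gφ y (t<s , y⊆x) =
      ⊨-resp-SameCouple φ (classOf-member y g∈y) (x⊨Gφ _ (y⊆x _ g∈y) (time y) (member-Hist y g∈y) t<s)
      where g∈y = representative-∈ y
    ⇐ : (∀ y → _≺_ indist x y → _⊨_ 𝔐 y φ) → _⊨_ 𝔐 x (G φ)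
    ⇐ □φ h h∈x s h∈Hₛ t<s = □φ (classOf indist s h h∈Hₛ) (t<s , λ k hIₛk →
      to (proj₂ (classOf-member x h∈x) k) (I.mono hIₛk t<s))

  ⊨-H⇔ : ∀ φ x → _⊨_ 𝔐 x (H φ) ⇔ (∀ y → _≻_ indist x y → _⊨_ 𝔐 y φ)
  ⊨-H⇔ φ x = mk⇔ ⇒ ⇐
    where
    ⇒ : _⊨_ 𝔐 x (H φ) → ∀ y → _≻_ indist x y → _⊨_ 𝔐 y φ
    ⇒ x⊨Hφ y (s<t , x⊆y) =
      ⊨-resp-SameCouple φ (classOf-member y h∈y) (x⊨Hφ _ h∈x (time y) (member-Hist y h∈y) s<t)
      where
      h∈x = representative-∈ x
      h∈y = x⊆y _ h∈x
    ⇐ : (∀ y → _≻_ indist x y → _⊨_ 𝔐 y φ) → _⊨_ 𝔐 x (H φ)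
    ⇐ □φ h h∈x s h∈Hₛ s<t = □φ (classOf indist s h h∈Hₛ) (s<t , λ k k∈x →
      I.mono (from (proj₂ (classOf-member x h∈x) k) k∈x) s<t)

  ⊨-L⇔ : ∀ φ x → _⊨_ 𝔐 x (L φ) ⇔ (∀ y → _∼_ indist x y → _⊨_ 𝔐 y φ)
  ⊨-L⇔ φ x = mk⇔
    (λ { x⊨Lφ y refl → x⊨Lφ (cls y) (isClass y) })
    (λ □φ ρ ρ∈Πₜ → □φ (couple (time x) ρ ρ∈Πₜ) refl)

module _ {𝔐 𝔐′ : Model} {x₀ : Couple (Model.indist 𝔐)} {x₀′ : Couple (Model.indist 𝔐′)}
         (bisim : Bisimulation 𝔐 𝔐′ x₀ x₀′) where
  open Bisimulation bisim
  open Model 𝔐 using (indist)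
  open Model 𝔐′ using () renaming (indist to indist′)
  module S = Semantics 𝔐
  module S′ = Semantics 𝔐′

  B⇒⊨⇔ : ∀ φ {x x′} → B x x′ → _⊨_ 𝔐 x φ ⇔ _⊨_ 𝔐′ x′ φ
  B⇒⊨⇔ (var p) xBx′ = mk⇔ (λ v → lift (to (PV xBx′ p) (lower v)))
                          (λ v → lift (from (PV xBx′ p) (lower v)))
  B⇒⊨⇔ (¬' φ) xBx′ = ¬-cong-⇔ (B⇒⊨⇔ φ xBx′)
  B⇒⊨⇔ (φ ∧' ψ) xBx′ = B⇒⊨⇔ φ xBx′ ×-⇔ B⇒⊨⇔ ψ xBx′
  B⇒⊨⇔ (G φ) {x} {x′} xBx′ = ⇔.trans (S.⊨-G⇔ φ x) (⇔.trans
    (□-cong-⇔ {x = x} {x′ = x′} (_≺_ indist) (_≺_ indist′) (≺-forth xBx′) (≺-back xBx′) (B⇒⊨⇔ φ))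
    (⇔.sym (S′.⊨-G⇔ φ x′)))
  B⇒⊨⇔ (H φ) {x} {x′} xBx′ = ⇔.trans (S.⊨-H⇔ φ x) (⇔.trans
    (□-cong-⇔ {x = x} {x′ = x′} (_≻_ indist) (_≻_ indist′) (≻-forth xBx′) (≻-back xBx′) (B⇒⊨⇔ φ))
    (⇔.sym (S′.⊨-H⇔ φ x′)))
  B⇒⊨⇔ (L φ) {x} {x′} xBx′ = ⇔.trans (S.⊨-L⇔ φ x) (⇔.trans
    (□-cong-⇔ {x = x} {x′ = x′} (_∼_ indist) (_∼_ indist′) (∼-forth xBx′) (∼-back xBx′) (B⇒⊨⇔ φ))
    (⇔.sym (S′.⊨-L⇔ φ x′)))

mainTheorem5 : (𝔐 𝔐' : Model) (x : Couple (Model.indist 𝔐)) (x' : Couple (Model.indist 𝔐'))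
    → Bisimulation 𝔐 𝔐' x x'
    → ∀ (φ : Formula) → (_⊨_ 𝔐 x φ ⇔ _⊨_ 𝔐' x' φ)
mainTheorem5 𝔐 𝔐' x x' bisim φ = B⇒⊨⇔ bisim φ (Bisimulation.root bisim)
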